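{- Let $H$ be a $5$-Ore graph. For any vertex $v\in V(H)$, there exists a diamond or emerald of $H$ not containing $v$. If $H\ne K_5$, then for any subgraph $T$ of $H$ isomorphic to $K_4$, there exists a diamond or emerald of $H$ vertex-disjoint from $T$.
   Context: All graphs are finite and simple. An Ore-composition of $G_1$ and $G_2$: delete an edge $xy$ of $G_1$, split a vertex $z$ of $G_2$ into two vertices $z_1,z_2$ of positive degree, identify $x$ with $z_1$ and $y$ with $z_2$. A graph is $5$-Ore if obtainable from copies of $K_5$ by repeated Ore-compositions. A diamond in $H$ is a subgraph isomorphic to $K_5-e$ in which the three vertices not incident to $e$ have degree four in $H$. An emerald in $H$ is a subgraph isomorphic to $K_4$ all of whose vertices have degree four in $H$. -}

module Defs where

open import Data.Nat using (ℕ; zero; suc; _+_; _≤_)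
open import Data.Bool using (Bool; true; false; _∧_; _∨_; not; if_then_else_)
open import Data.Fin using (Fin; toℕ; splitAt; punchIn; _≟_)
open import Data.Sum using (_⊎_; inj₁; inj₂)
open import Data.Product using (Σ; ∃; ∃-syntax; _×_; _,_)
open import Data.List using (List; map)
open import Data.Nat.ListAction using (sum)
open import Data.List.Base using (allFin)
open import Relation.Nullary using (¬_)
open import Relation.Nullary.Decidable using (⌊_⌋)
open import Relation.Binary.PropositionalEquality using (_≡_; _≢_)
open import Function.Definitions using (Injective)

-- A (finite) graph on vertex set Fin n, given by its adjacency matrix.
-- (Symmetry / irreflexivity are not built in; K5 is simple and the
-- Ore-composition below preserves simplicity, so every 5-Ore graph is simple.)
record Graph (n : ℕ) : Set where
  constructor mkGraph
  field
    adj : Fin n → Fin n → Bool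
open Graph public

degree : ∀ {n} → Graph n → Fin n → ℕ
degree {n} G v = sum (map (λ u → if adj G v u then 1 else 0) (allFin n))

record _≅_ {n m : ℕ} (G : Graph n) (H : Graph m) : Set where
  field
    to      : Fin n → Fin m
    from    : Fin m → Fin n
    from-to : ∀ u → from (to u) ≡ u
    to-from : ∀ w → to (from w) ≡ w
    adj-pres : ∀ u v → adj H (to u) (to v) ≡ adj G u v

K5 : Graph 5
K5 = mkGraph (λ i j → not ⌊ i ≟ j ⌋)

-- G1 on Fin a with edge xy deleted; G2 on Fin (suc k),
-- vertex z split into z1 (identified with x) and z2 (identified with y):
-- the neighbour (punchIn z j) of z goes to z1 if side j = true, to z2 otherwise.
-- The vertices of the result are Fin a ⊎ Fin k  (≅ Fin (a + k) via splitAt),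
-- where Fin k enumerates V(G2) - z via punchIn z.
module _ {a k : ℕ} (G1 : Graph a) (G2 : Graph (suc k))
         (x y : Fin a) (z : Fin (suc k)) (side : Fin k → Bool) where

  private
    isXY : Fin a → Fin a → Bool
    isXY u w = (⌊ u ≟ x ⌋ ∧ ⌊ w ≟ y ⌋) ∨ (⌊ u ≟ y ⌋ ∧ ⌊ w ≟ x ⌋)

    cross : Fin a → Fin k → Bool
    cross u j = adj G2 z (punchIn z j)
                ∧ ((⌊ u ≟ x ⌋ ∧ side j) ∨ (⌊ u ≟ y ⌋ ∧ not (side j)))

    cadj : Fin a ⊎ Fin k → Fin a ⊎ Fin k → Bool
    cadj (inj₁ u) (inj₁ w) = adj G1 u w ∧ not (isXY u w)
    cadj (inj₂ i) (inj₂ j) = adj G2 (punchIn z i) (punchIn z j)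
    cadj (inj₁ u) (inj₂ j) = cross u j
    cadj (inj₂ j) (inj₁ u) = cross u j

  oreCompose : Graph (a + k)
  oreCompose = mkGraph (λ u w → cadj (splitAt a u) (splitAt a w))

data Is5Ore : ∀ {n} → Graph n → Set where
  base : ∀ {n} {G : Graph n} → G ≅ K5 → Is5Ore G
  comp : ∀ {a k} {G1 : Graph a} {G2 : Graph (suc k)}
           {x y : Fin a} {z : Fin (suc k)} {side : Fin k → Bool}
       → Is5Ore G1 → Is5Ore G2
       → adj G1 x y ≡ true → x ≢ y
       → (∃[ j ] (adj G2 z (punchIn z j) ≡ true × side j ≡ true))
       → (∃[ j ] (adj G2 z (punchIn z j) ≡ true × side j ≡ false))
       → ∀ {n} {H : Graph n} → H ≅ oreCompose G1 G2 x y z side → Is5Ore H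

-- diamond: injective vs : Fin 5 → V(H); the missing edge e is {vs 0, vs 1};
-- all other pairs adjacent; vs 2, vs 3, vs 4 have degree 4 in H.
record IsDiamond {n} (H : Graph n) (vs : Fin 5 → Fin n) : Set where
  field
    inj  : Injective _≡_ _≡_ vs
    edges : ∀ i j → i ≢ j → ¬ (toℕ i ≤ 1 × toℕ j ≤ 1) → adj H (vs i) (vs j) ≡ true
    deg4 : ∀ i → 2 ≤ toℕ i → degree H (vs i) ≡ 4

record IsK4 {n} (H : Graph n) (vs : Fin 4 → Fin n) : Set where
  field
    inj  : Injective _≡_ _≡_ vs
    edges : ∀ i j → i ≢ j → adj H (vs i) (vs j) ≡ true

record IsEmerald {n} (H : Graph n) (vs : Fin 4 → Fin n) : Set where
  field
    k4   : IsK4 H vs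
    deg4 : ∀ i → degree H (vs i) ≡ 4

DiamondOrEmeraldAvoiding : ∀ {n} → Graph n → (Fin n → Set) → Set
DiamondOrEmeraldAvoiding {n} H Bad =
    (∃[ d ] (IsDiamond H d × (∀ i → ¬ Bad (d i))))
  ⊎ (∃[ e ] (IsEmerald H e × (∀ i → ¬ Bad (e i))))

module Submission where

-- Lemma 2.7.  Call a diamond or an emerald a gem.  By induction on the Ore construction, every
-- 5-Ore graph H has a symmetric adjacency matrix and satisfies
--   (A) every vertex of H is avoided by some gem,
--   (C) for every edge pq of H, some gem has neither p nor q among its core (degree-4) vertices,
--   and H is K5 or (B) every K4 of H is vertex-disjoint from some gem.
-- K5 satisfies (A) and (C) directly.  For an Ore-composition O of G1 (edge xy deleted) and G2
-- (vertex z split), gems of G1 whose core avoids x and y (by (C) for G1 at xy) and gems of G2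
-- avoiding z (by (A) for G2) are still gems of O: their edges and the degrees of their core
-- vertices survive.  (A) and (C) for O follow by taking such a gem on the side away from the
-- given vertex or edge.  A K4 of O meeting both sides contains x (or, symmetrically, y) and
-- contracts to a K4 of G2 through z; then (B) for G2 applies, or, if G2 = K5, (A) for G1 at x
-- does, y keeping its degree because three of the four neighbours of z go to x.

open import Defs
open import Data.Nat using (ℕ; zero; suc; _+_; _≤_; _≤?_; z≤n; s≤s)
open import Data.Nat.Properties
  using (+-0-commutativeMonoid; +-assoc; +-comm; +-identityʳ; +-mono-≤; +-monoˡ-≤; +-cancelˡ-≤;
         ≤-antisym; ≤-trans; ≰⇒>; ≤-reflexive; module ≤-Reasoning)
import Data.Nat.ListAction as List
open import Data.Bool using (Bool; true; false; _∧_; _∨_; not; if_then_else_)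
open import Data.Bool.Properties using (∧-identityʳ; ∧-zeroʳ; ∨-identityʳ; ∨-comm; ∧-comm; ¬-not; if-float)
open import Data.List using (tabulate)
open import Data.List.Properties using (map-tabulate)
open import Data.Fin using (Fin; zero; suc; toℕ; _↑ˡ_; _↑ʳ_; punchIn; punchOut; _≟_; splitAt; join; lift)
open import Data.Fin.Properties
  using (0≢1+n; suc-injective; punchInᵢ≢i; punchIn-punchOut; punchOut-injective; punchOut-cong;
         punchIn-injective; lift-injective;
         splitAt-↑ˡ; splitAt-↑ʳ; join-splitAt; ↑ˡ-injective; ↑ʳ-injective; any?)
open import Data.Fin.Permutation using (permutation)
open import Algebra.Properties.CommutativeMonoid.Sum +-0-commutativeMonoid
  using (∑-distrib-+; sum-cong-≗; sum-remove; sum-permute) renaming (sum to ∑)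
open import Data.Product using (∃-syntax; _×_; _,_; proj₁; proj₂)
open import Data.Sum using (_⊎_; inj₁; inj₂; [_,_]′) renaming (map to ⊎-map)
open import Data.Empty using (⊥; ⊥-elim)
open import Relation.Unary using (∅)
open import Relation.Nullary using (¬_; Dec; yes; no)
open import Relation.Nullary.Decidable using (⌊_⌋)
open import Relation.Binary.PropositionalEquality
  using (_≡_; _≢_; refl; sym; trans; cong; cong₂; subst; module ≡-Reasoning)
open import Function using (_∘_; id)
open import Function.Definitions using (Injective)

≟-refl : ∀ {n} (p : Fin n) → ⌊ p ≟ p ⌋ ≡ true
≟-refl p with p ≟ p
... | yes _   = refl
... | no p≢p = ⊥-elim (p≢p refl)

≟-≢ : ∀ {n} {p q : Fin n} → p ≢ q → ⌊ p ≟ q ⌋ ≡ false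
≟-≢ {p = p} {q} p≢q with p ≟ q
... | yes p≡q = ⊥-elim (p≢q p≡q)
... | no _    = refl

≟-true : ∀ {n} {p q : Fin n} → ⌊ p ≟ q ⌋ ≡ true → p ≡ q
≟-true {p = p} {q} eq with p ≟ q
... | yes p≡q = p≡q

≟-sym : ∀ {n} (p q : Fin n) → ⌊ p ≟ q ⌋ ≡ ⌊ q ≟ p ⌋
≟-sym p q with p ≟ q
... | yes refl = sym (≟-refl p)
... | no p≢q   = sym (≟-≢ (p≢q ∘ sym))

∧-true : ∀ {a b} → a ∧ b ≡ true → a ≡ true × b ≡ true
∧-true {true} {true} refl = refl , refl

∨-true : ∀ {a b} → a ∨ b ≡ true → a ≡ true ⊎ b ≡ true
∨-true {true}  _  = inj₁ refl
∨-true {false} eq = inj₂ eq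

ind : Bool → ℕ
ind b = if b then 1 else 0

count : ∀ {n} → (Fin n → Bool) → ℕ
count b = ∑ (ind ∘ b)

degree≡count : ∀ {n} (G : Graph n) v → degree G v ≡ count (adj G v)
degree≡count {n} G v =
  trans (cong List.sum (map-tabulate {n = n} id (ind ∘ adj G v))) (sum-tabulate (ind ∘ adj G v))
  where
  sum-tabulate : ∀ {m} (f : Fin m → ℕ) → List.sum (tabulate f) ≡ ∑ f
  sum-tabulate {zero}  f = refl
  sum-tabulate {suc m} f = cong (f zero +_) (sum-tabulate (f ∘ suc))

count-cong : ∀ {n} {b b′ : Fin n → Bool} → (∀ i → b i ≡ b′ i) → count b ≡ count b′
count-cong eq = sum-cong-≗ (cong ind ∘ eq)

count-none : ∀ {n} {b : Fin n → Bool} → (∀ i → b i ≡ false) → count b ≡ 0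
count-none {zero}  none = refl
count-none {suc n} none rewrite none zero = count-none (none ∘ suc)

count-remove : ∀ {n} (b : Fin (suc n) → Bool) p → count b ≡ ind (b p) + count (b ∘ punchIn p)
count-remove b p = sum-remove {i = p} (ind ∘ b)

count-↑ : ∀ a {k} (b : Fin (a + k) → Bool) → count b ≡ count (λ u → b (u ↑ˡ k)) + count (λ j → b (a ↑ʳ j))
count-↑ zero    b = refl
count-↑ (suc a) b = trans (cong (ind (b zero) +_) (count-↑ a (b ∘ suc))) (sym (+-assoc (ind (b zero)) _ _))

count-bijection : ∀ {n m} (to : Fin n → Fin m) (from : Fin m → Fin n)
                → (∀ u → from (to u) ≡ u) → (∀ w → to (from w) ≡ w)
                → ∀ b → count (b ∘ to) ≡ count b
count-bijection to from from-to to-from b = sym (sum-permute (ind ∘ b) (permutation to from to-from from-to))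

count-at : ∀ {n} (b : Fin n → Bool) p → count (λ w → b w ∧ ⌊ w ≟ p ⌋) ≡ ind (b p)
count-at {suc n} b p = begin
  count (λ w → b w ∧ ⌊ w ≟ p ⌋)
    ≡⟨ count-remove (λ w → b w ∧ ⌊ w ≟ p ⌋) p ⟩
  ind (b p ∧ ⌊ p ≟ p ⌋) + count (λ j → b (punchIn p j) ∧ ⌊ punchIn p j ≟ p ⌋)
    ≡⟨ cong₂ _+_ (cong (ind ∘ (b p ∧_)) (≟-refl p)) (count-none off-p) ⟩
  ind (b p ∧ true) + 0
    ≡⟨ trans (+-identityʳ _) (cong ind (∧-identityʳ (b p))) ⟩
  ind (b p) ∎
  where
  open ≡-Reasoning
  off-p : ∀ j → b (punchIn p j) ∧ ⌊ punchIn p j ≟ p ⌋ ≡ false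
  off-p j = trans (cong (b (punchIn p j) ∧_) (≟-≢ (punchInᵢ≢i p j))) (∧-zeroʳ _)

count-split : ∀ {n} (b s : Fin n → Bool)
            → count b ≡ count (λ i → b i ∧ s i) + count (λ i → b i ∧ not (s i))
count-split b s = trans (sum-cong-≗ (λ i → split (b i) (s i)))
                        (∑-distrib-+ (λ i → ind (b i ∧ s i)) (λ i → ind (b i ∧ not (s i))))
  where
  split : ∀ c t → ind c ≡ ind (c ∧ t) + ind (c ∧ not t)
  split true  true  = refl
  split true  false = refl
  split false _     = refl

count-≥ : ∀ {m k} (b : Fin k → Bool) (f : Fin m → Fin k) → Injective _≡_ _≡_ f
        → (∀ i → b (f i) ≡ true) → m ≤ count b
count-≥ {zero}          b f f-inj true-on-f = z≤n
count-≥ {suc m} {zero}  b f f-inj true-on-f with f zero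
... | ()
count-≥ {suc m} {suc k} b f f-inj true-on-f = begin
  1 + m                                 ≤⟨ +-mono-≤ (≤-reflexive (cong ind (sym (true-on-f zero)))) rest ⟩
  ind (b (f zero)) + count (b ∘ punchIn (f zero)) ≡⟨ sym (count-remove b (f zero)) ⟩
  count b                               ∎
  where
  open ≤-Reasoning
  others : ∀ i → f zero ≢ f (suc i)
  others i eq = 0≢1+n (f-inj eq)
  f′ : Fin m → Fin k
  f′ i = punchOut (others i)
  rest : m ≤ count (b ∘ punchIn (f zero))
  rest = count-≥ (b ∘ punchIn (f zero)) f′
    (λ eq → suc-injective (f-inj (punchOut-injective (others _) (others _) eq)))
    (λ i → trans (cong b (punchIn-punchOut (others i))) (true-on-f (suc i)))

-- Taking R nonempty is what lets the induction
-- survive the deletion of an edge in an Ore-composition.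
data Gem {n} (G : Graph n) (B R : Fin n → Set) : Set where
  diamond : ∀ d → IsDiamond G d → (∀ i → ¬ B (d i)) → (∀ i → 2 ≤ toℕ i → ¬ R (d i)) → Gem G B R
  emerald : ∀ e → IsEmerald G e → (∀ i → ¬ B (e i)) → (∀ i → ¬ R (e i)) → Gem G B R

Gem⇒DiamondOrEmerald : ∀ {n} {G : Graph n} {B} → Gem G B ∅ → DiamondOrEmeraldAvoiding G B
Gem⇒DiamondOrEmerald (diamond d D avoid _) = inj₁ (d , D , avoid)
Gem⇒DiamondOrEmerald (emerald e E avoid _) = inj₂ (e , E , avoid)

-- Conditions under which f maps gems of G (avoiding B, core outside R) to gems of G′ (avoiding
-- B′, core outside R′): f is injective on the allowed vertices, keeps every edge with an endpoint
-- outside R (these are all the edges of a gem), and keeps the degree of allowed core vertices.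
record GemMap {n m} (G : Graph n) (G′ : Graph m) (B R : Fin n → Set) (B′ R′ : Fin m → Set)
              (f : Fin n → Fin m) : Set where
  field
    injective    : ∀ {u w} → ¬ B u → ¬ B w → f u ≡ f w → u ≡ w
    keeps-edge   : ∀ {u w} → ¬ B u → ¬ B w → ¬ R u ⊎ ¬ R w → adj G u w ≡ true → adj G′ (f u) (f w) ≡ true
    keeps-degree : ∀ {w} → ¬ B w → ¬ R w → degree G′ (f w) ≡ degree G w
    avoids       : ∀ {u} → ¬ B u → ¬ B′ (f u)
    core-avoids  : ∀ {u} → ¬ B u → ¬ R u → ¬ R′ (f u)

module _ {n m} {G : Graph n} {G′ : Graph m} {B R : Fin n → Set} {B′ R′ : Fin m → Set}
         {f : Fin n → Fin m} (F : GemMap G G′ B R B′ R′ f) where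
  open GemMap F

  map-gem : Gem G B R → Gem G′ B′ R′
  map-gem (diamond d D avoid core) =
    diamond (f ∘ d) D′ (avoids ∘ avoid) (λ i 2≤i → core-avoids (avoid i) (core i 2≤i))
    where
    open IsDiamond D
    core-end : ∀ i j → ¬ (toℕ i ≤ 1 × toℕ j ≤ 1) → ¬ R (d i) ⊎ ¬ R (d j)
    core-end i j not-missing with toℕ i ≤? 1
    ... | yes i≤1 = inj₂ (core j (≰⇒> (λ j≤1 → not-missing (i≤1 , j≤1))))
    ... | no  i≰1 = inj₁ (core i (≰⇒> i≰1))
    D′ : IsDiamond G′ (f ∘ d)
    D′ = record
      { inj   = inj ∘ injective (avoid _) (avoid _)
      ; edges = λ i j i≢j nm → keeps-edge (avoid i) (avoid j) (core-end i j nm) (edges i j i≢j nm)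
      ; deg4  = λ i 2≤i → trans (keeps-degree (avoid i) (core i 2≤i)) (deg4 i 2≤i)
      }
  map-gem (emerald e E avoid core) =
    emerald (f ∘ e) E′ (avoids ∘ avoid) (λ i → core-avoids (avoid i) (core i))
    where
    open IsEmerald E
    E′ : IsEmerald G′ (f ∘ e)
    E′ = record
      { k4   = record
        { inj   = IsK4.inj k4 ∘ injective (avoid _) (avoid _)
        ; edges = λ i j i≢j → keeps-edge (avoid i) (avoid j) (inj₁ (core i)) (IsK4.edges k4 i j i≢j) }
      ; deg4 = λ i → trans (keeps-degree (avoid i) (core i)) (deg4 i)
      }

-- Symmetry is needed to compute degrees in an
-- Ore-composition; (C) is the strengthening of (A) that survives edge deletion; (B) is the second
-- half of the theorem.
Symmetric : ∀ {n} → Graph n → Set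
Symmetric {n} G = ∀ (u w : Fin n) → adj G u w ≡ adj G w u

AvoidsVertices : ∀ {n} → Graph n → Set
AvoidsVertices {n} G = ∀ (v : Fin n) → Gem G (_≡ v) ∅

CoreAvoidsEdges : ∀ {n} → Graph n → Set
CoreAvoidsEdges {n} G = ∀ (p q : Fin n) → adj G p q ≡ true → Gem G ∅ (λ u → u ≡ p ⊎ u ≡ q)

AvoidsK4s : ∀ {n} → Graph n → Set
AvoidsK4s {n} G = ∀ (T : Fin 4 → Fin n) → IsK4 G T → Gem G (λ u → ∃[ j ] (T j ≡ u)) ∅

record OreInvariants {n} (G : Graph n) : Set where
  field
    symmetric         : Symmetric G
    avoids-vertices   : AvoidsVertices G
    core-avoids-edges : CoreAvoidsEdges G

module Isomorphic {n m} {H : Graph n} {G : Graph m} (iso : H ≅ G) where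
  open _≅_ iso

  from-≡ : ∀ {u v} → from u ≡ v → u ≡ to v
  from-≡ {u} eq = trans (sym (to-from u)) (cong to eq)

  adj-from : ∀ u w → adj H (from u) (from w) ≡ adj G u w
  adj-from u w = trans (sym (adj-pres (from u) (from w))) (cong₂ (adj G) (to-from u) (to-from w))

  degree-to : ∀ v → degree G (to v) ≡ degree H v
  degree-to v = begin
    degree G (to v)            ≡⟨ degree≡count G (to v) ⟩
    count (adj G (to v))       ≡⟨ count-bijection to from from-to to-from (adj G (to v)) ⟨
    count (adj G (to v) ∘ to)  ≡⟨ count-cong (adj-pres v) ⟩
    count (adj H v)            ≡⟨ degree≡count H v ⟨
    degree H v                 ∎
    where open ≡-Reasoning

  pull-back : ∀ {B R : Fin m → Set} {B′ R′ : Fin n → Set}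
            → (∀ {u} → ¬ B u → ¬ B′ (from u)) → (∀ {u} → ¬ R u → ¬ R′ (from u))
            → Gem G B R → Gem H B′ R′
  pull-back avoids core-avoids = map-gem (record
    { injective    = λ _ _ eq → trans (from-≡ eq) (to-from _)
    ; keeps-edge   = λ {u} {w} _ _ _ e → trans (adj-from u w) e
    ; keeps-degree = λ {w} _ _ → trans (sym (degree-to (from w))) (cong (degree G) (to-from w))
    ; avoids       = avoids
    ; core-avoids  = λ _ → core-avoids
    })

  invariants : OreInvariants G → OreInvariants H
  invariants I = record
    { symmetric         = λ u w → trans (sym (adj-pres u w)) (trans (symmetric (to u) (to w)) (adj-pres w u))
    ; avoids-vertices   = λ v → pull-back (λ u≢ eq → u≢ (from-≡ eq)) id (avoids-vertices (to v))
    ; core-avoids-edges = λ p q pq → pull-back id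
        (λ not-end → not-end ∘ ⊎-map from-≡ from-≡)
        (core-avoids-edges (to p) (to q) (trans (adj-pres p q) pq))
    }
    where open OreInvariants I

  avoids-K4s : AvoidsK4s G → AvoidsK4s H
  avoids-K4s A T K = pull-back (λ { outside (j , eq) → outside (j , sym (from-≡ (sym eq))) }) id (A (to ∘ T) K′)
    where
    K′ : IsK4 G (to ∘ T)
    K′ = record
      { inj   = λ eq → IsK4.inj K (trans (sym (from-to _)) (trans (cong from eq) (from-to _)))
      ; edges = λ i j i≢j → trans (adj-pres (T i) (T j)) (IsK4.edges K i j i≢j) }

K5-symmetric : Symmetric K5
K5-symmetric u w = cong not (≟-sym u w)

K5-adj : ∀ {u w : Fin 5} → u ≢ w → adj K5 u w ≡ true
K5-adj u≢w = cong not (≟-≢ u≢w)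

K5-adj⇒≢ : ∀ {u w : Fin 5} → adj K5 u w ≡ true → u ≢ w
K5-adj⇒≢ {u} uw refl with trans (sym uw) (cong not (≟-refl u))
... | ()

K5-degree : ∀ u → degree K5 u ≡ 4
K5-degree zero                         = refl
K5-degree (suc zero)                   = refl
K5-degree (suc (suc zero))             = refl
K5-degree (suc (suc (suc zero)))       = refl
K5-degree (suc (suc (suc (suc zero)))) = refl

K5-diamond : ∀ d → Injective _≡_ _≡_ d → IsDiamond K5 d
K5-diamond d d-inj = record
  { inj   = d-inj
  ; edges = λ i j i≢j _ → K5-adj (i≢j ∘ d-inj)
  ; deg4  = λ i _ → K5-degree (d i) }

K5-emerald : ∀ e → Injective _≡_ _≡_ e → IsEmerald K5 e
K5-emerald e e-inj = record
  { k4   = record { inj = e-inj ; edges = λ i j i≢j → K5-adj (i≢j ∘ e-inj) }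
  ; deg4 = λ i → K5-degree (e i) }

startAt : ∀ {n} → Fin (suc n) → Fin (suc n) → Fin (suc n)
startAt p zero    = p
startAt p (suc i) = punchIn p i

startAt-injective : ∀ {n} (p : Fin (suc n)) → Injective _≡_ _≡_ (startAt p)
startAt-injective p {zero}  {zero}  _  = refl
startAt-injective p {zero}  {suc j} eq = ⊥-elim (punchInᵢ≢i p j (sym eq))
startAt-injective p {suc i} {zero}  eq = ⊥-elim (punchInᵢ≢i p i eq)
startAt-injective p {suc i} {suc j} eq = cong suc (punchIn-injective p i j eq)

startAt₂ : ∀ {n} {p q : Fin (suc (suc n))} → p ≢ q → Fin (suc (suc n)) → Fin (suc (suc n))
startAt₂ {p = p} p≢q = startAt p ∘ lift 1 (startAt (punchOut p≢q))

startAt₂-injective : ∀ {n} {p q : Fin (suc (suc n))} (p≢q : p ≢ q) → Injective _≡_ _≡_ (startAt₂ p≢q)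
startAt₂-injective {p = p} p≢q = lift-injective _ (startAt-injective (punchOut p≢q)) 1 ∘ startAt-injective p

K5-invariants : OreInvariants K5
K5-invariants = record
  { symmetric         = K5-symmetric
  ; avoids-vertices   = λ v → emerald (punchIn v) (K5-emerald (punchIn v) (punchIn-injective v _ _))
                                      (punchInᵢ≢i v) (λ _ ())
  ; core-avoids-edges = λ p q pq → let p≢q = K5-adj⇒≢ pq in
      diamond (startAt₂ p≢q) (K5-diamond _ (startAt₂-injective p≢q)) (λ _ ()) (core p≢q)
  }
  where
  core : ∀ {p q : Fin 5} (p≢q : p ≢ q) i → 2 ≤ toℕ i → ¬ (startAt₂ p≢q i ≡ p ⊎ startAt₂ p≢q i ≡ q)
  core p≢q i 2≤i (inj₁ eq) with startAt₂-injective p≢q {i} {zero} eq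
  ... | refl with 2≤i
  ...   | ()
  core p≢q i 2≤i (inj₂ eq) with startAt₂-injective p≢q {i} {suc zero} (trans eq (sym (punchIn-punchOut p≢q)))
  ... | refl with 2≤i
  ...   | s≤s ()

module Ore {a k : ℕ} (G1 : Graph a) (G2 : Graph (suc k))
           (x y : Fin a) (z : Fin (suc k)) (side : Fin k → Bool) where

  O : Graph (a + k)
  O = oreCompose G1 G2 x y z side

  ι₁ : Fin a → Fin (a + k)
  ι₁ u = u ↑ˡ k

  ι₂ : Fin k → Fin (a + k)
  ι₂ j = a ↑ʳ j

  deleted : Fin a → Fin a → Bool
  deleted u w = (⌊ u ≟ x ⌋ ∧ ⌊ w ≟ y ⌋) ∨ (⌊ u ≟ y ⌋ ∧ ⌊ w ≟ x ⌋)

  toZ : Fin k → Bool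
  toZ j = adj G2 z (punchIn z j)

  target : Fin k → Fin a
  target j = if side j then x else y

  cross : Fin a → Fin k → Bool
  cross u j = toZ j ∧ ((⌊ u ≟ x ⌋ ∧ side j) ∨ (⌊ u ≟ y ⌋ ∧ not (side j)))

  adj-ι₁ι₁ : ∀ u w → adj O (ι₁ u) (ι₁ w) ≡ adj G1 u w ∧ not (deleted u w)
  adj-ι₁ι₁ u w rewrite splitAt-↑ˡ a u k | splitAt-↑ˡ a w k = refl

  adj-ι₂ι₂ : ∀ i j → adj O (ι₂ i) (ι₂ j) ≡ adj G2 (punchIn z i) (punchIn z j)
  adj-ι₂ι₂ i j rewrite splitAt-↑ʳ a k i | splitAt-↑ʳ a k j = refl

  adj-ι₁ι₂ : ∀ u j → adj O (ι₁ u) (ι₂ j) ≡ cross u j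
  adj-ι₁ι₂ u j rewrite splitAt-↑ˡ a u k | splitAt-↑ʳ a k j = refl

  adj-ι₂ι₁ : ∀ j u → adj O (ι₂ j) (ι₁ u) ≡ cross u j
  adj-ι₂ι₁ j u rewrite splitAt-↑ˡ a u k | splitAt-↑ʳ a k j = refl

  data Part : Fin (a + k) → Set where
    in₁ : ∀ u → Part (ι₁ u)
    in₂ : ∀ j → Part (ι₂ j)

  part : ∀ v → Part v
  part v with splitAt a v in eq
  ... | inj₁ u = subst Part (trans (cong (join a k) (sym eq)) (join-splitAt a k v)) (in₁ u)
  ... | inj₂ j = subst Part (trans (cong (join a k) (sym eq)) (join-splitAt a k v)) (in₂ j)

  ι₁-injective : ∀ {u w} → ι₁ u ≡ ι₁ w → u ≡ w
  ι₁-injective = ↑ˡ-injective k _ _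

  ι₂-injective : ∀ {i j} → ι₂ i ≡ ι₂ j → i ≡ j
  ι₂-injective = ↑ʳ-injective a _ _

  ι₁≢ι₂ : ∀ {u j} → ι₁ u ≢ ι₂ j
  ι₁≢ι₂ {u} {j} eq with trans (sym (splitAt-↑ˡ a u k)) (trans (cong (splitAt a) eq) (splitAt-↑ʳ a k j))
  ... | ()

  deleted-ends : ∀ {u w} → deleted u w ≡ true → (u ≡ x × w ≡ y) ⊎ (u ≡ y × w ≡ x)
  deleted-ends uw with ∨-true uw
  ... | inj₁ xy = let (ux , wy) = ∧-true xy in inj₁ (≟-true ux , ≟-true wy)
  ... | inj₂ yx = let (uy , wx) = ∧-true yx in inj₂ (≟-true uy , ≟-true wx)

  keeps-edge₁ : ∀ {u w} → deleted u w ≡ false → adj G1 u w ≡ true → adj O (ι₁ u) (ι₁ w) ≡ true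
  keeps-edge₁ {u} {w} kept uw = trans (adj-ι₁ι₁ u w) (cong₂ (λ p q → p ∧ not q) uw kept)

  xy-deleted : adj O (ι₁ x) (ι₁ y) ≡ false
  xy-deleted = trans (adj-ι₁ι₁ x y)
    (trans (cong₂ (λ p q → adj G1 x y ∧ not ((p ∧ q) ∨ (⌊ x ≟ y ⌋ ∧ ⌊ y ≟ x ⌋))) (≟-refl x) (≟-refl y))
           (∧-zeroʳ _))

  cross-target : ∀ u j → cross u j ≡ toZ j ∧ ⌊ u ≟ target j ⌋
  cross-target u j = cong (toZ j ∧_) (trans (select (side j) _ _) (sym (if-float (λ t → ⌊ u ≟ t ⌋) (side j))))
    where
    select : ∀ s p q → (p ∧ s) ∨ (q ∧ not s) ≡ (if s then p else q)
    select true  p q = trans (cong₂ _∨_ (∧-identityʳ p) (∧-zeroʳ q)) (∨-identityʳ p)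
    select false p q = cong₂ _∨_ (∧-zeroʳ p) (∧-identityʳ q)

  cross-end : ∀ {u j} → cross u j ≡ true → toZ j ≡ true × u ≡ target j
  cross-end {u} {j} uj = let (zj , u-target) = ∧-true (trans (sym (cross-target u j)) uj) in zj , ≟-true u-target

  target-end : ∀ j → target j ≡ x ⊎ target j ≡ y
  target-end j with side j
  ... | true  = inj₁ refl
  ... | false = inj₂ refl

  cross-ends : ∀ {u j} → cross u j ≡ true → u ≡ x ⊎ u ≡ y
  cross-ends {u} {j} uj with target-end j | proj₂ (cross-end uj)
  ... | inj₁ tx | u-target = inj₁ (trans u-target tx)
  ... | inj₂ ty | u-target = inj₂ (trans u-target ty)

  to-y : ∃[ j ] (toZ j ≡ true × side j ≡ false) → ∃[ j ] (cross y j ≡ true)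
  to-y (j , zj , sj) = j , trans (cross-target y j)
    (cong₂ _∧_ zj (trans (cong (λ s → ⌊ y ≟ (if s then x else y) ⌋) sj) (≟-refl y)))

  cross-off : ∀ {u} → u ≢ x → u ≢ y → ∀ j → cross u j ≡ false
  cross-off u≢x u≢y j = ¬-not λ uj → [ u≢x , u≢y ]′ (cross-ends uj)

  -- Degrees in O: a vertex of G1 keeps its G1-edges except xy and gains its cross edges; a
  -- vertex of G2 − z keeps its G2 − z edges and its edge to z becomes one cross edge.
  degree-ι₁ : ∀ u → degree O (ι₁ u) ≡ count (λ w → adj G1 u w ∧ not (deleted u w)) + count (cross u)
  degree-ι₁ u = trans (degree≡count O (ι₁ u))
    (trans (count-↑ a (adj O (ι₁ u))) (cong₂ _+_ (count-cong (adj-ι₁ι₁ u)) (count-cong (adj-ι₁ι₂ u))))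

  degree-ι₂ : ∀ i → degree O (ι₂ i) ≡ count (λ w → cross w i) + count (adj G2 (punchIn z i) ∘ punchIn z)
  degree-ι₂ i = trans (degree≡count O (ι₂ i))
    (trans (count-↑ a (adj O (ι₂ i))) (cong₂ _+_ (count-cong (adj-ι₂ι₁ i)) (count-cong (adj-ι₂ι₂ i))))

  degree-kept₁ : ∀ {u} → u ≢ x → u ≢ y → degree O (ι₁ u) ≡ degree G1 u
  degree-kept₁ {u} u≢x u≢y = begin
    degree O (ι₁ u)                                                  ≡⟨ degree-ι₁ u ⟩
    count (λ w → adj G1 u w ∧ not (deleted u w)) + count (cross u)
                                                                     ≡⟨ cong₂ _+_ (count-cong kept) (count-none (cross-off u≢x u≢y)) ⟩
    count (adj G1 u) + 0                                             ≡⟨ +-identityʳ _ ⟩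
    count (adj G1 u)                                                 ≡⟨ degree≡count G1 u ⟨
    degree G1 u                                                      ∎
    where
    open ≡-Reasoning
    kept : ∀ w → adj G1 u w ∧ not (deleted u w) ≡ adj G1 u w
    kept w = trans (cong (λ t → adj G1 u w ∧ not t) (¬-not (λ uw → u-not-end (deleted-ends uw)))) (∧-identityʳ _)
      where
      u-not-end : ¬ ((u ≡ x × w ≡ y) ⊎ (u ≡ y × w ≡ x))
      u-not-end (inj₁ (u≡x , _)) = u≢x u≡x
      u-not-end (inj₂ (u≡y , _)) = u≢y u≡y

  degree-kept₂ : Symmetric G2 → ∀ i → degree O (ι₂ i) ≡ degree G2 (punchIn z i)
  degree-kept₂ sym₂ i = begin
    degree O (ι₂ i)                                                     ≡⟨ degree-ι₂ i ⟩
    count (λ w → cross w i) + count (adj G2 (punchIn z i) ∘ punchIn z) ≡⟨ cong (_+ _) to-target ⟩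
    ind (adj G2 (punchIn z i) z) + count (adj G2 (punchIn z i) ∘ punchIn z)
                                                                        ≡⟨ count-remove (adj G2 (punchIn z i)) z ⟨
    count (adj G2 (punchIn z i))                                        ≡⟨ degree≡count G2 (punchIn z i) ⟨
    degree G2 (punchIn z i)                                             ∎
    where
    open ≡-Reasoning
    to-target : count (λ w → cross w i) ≡ ind (adj G2 (punchIn z i) z)
    to-target = trans (count-cong (λ w → cross-target w i))
                      (trans (count-at (λ _ → toZ i) (target i)) (cong ind (sym₂ z (punchIn z i))))

  cross-count : x ≢ y → count (cross x) + count (cross y) ≡ count toZ
  cross-count x≢y = trans (sym (∑-distrib-+ (ind ∘ cross x) (ind ∘ cross y))) (sum-cong-≗ shared)
    where
    shared : ∀ j → ind (cross x j) + ind (cross y j) ≡ ind (toZ j)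
    shared j rewrite cross-target x j | cross-target y j with target-end j
    ... | inj₁ tx rewrite tx | ≟-refl x | ≟-≢ (x≢y ∘ sym) = at-first (toZ j)
      where at-first : ∀ c → ind (c ∧ true) + ind (c ∧ false) ≡ ind c
            at-first true  = refl
            at-first false = refl
    ... | inj₂ ty rewrite ty | ≟-refl y | ≟-≢ x≢y = at-second (toZ j)
      where at-second : ∀ c → ind (c ∧ false) + ind (c ∧ true) ≡ ind c
            at-second true  = refl
            at-second false = refl

  -- y keeps its degree if it receives exactly one edge of z, replacing the deleted edge xy.
  degree-kept-y : x ≢ y → adj G1 y x ≡ true → count (cross y) ≡ 1 → degree O (ι₁ y) ≡ degree G1 y
  degree-kept-y x≢y yx one = begin
    degree O (ι₁ y)                                         ≡⟨ degree-ι₁ y ⟩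
    count (λ w → adj G1 y w ∧ not (deleted y w)) + count (cross y)
                                                            ≡⟨ cong₂ _+_ (count-cong not-deleted-y) one ⟩
    count off-x + 1                                         ≡⟨ cong (count off-x +_) one-at-x ⟨
    count off-x + count at-x                                ≡⟨ +-comm (count off-x) (count at-x) ⟩
    count at-x + count off-x                                ≡⟨ count-split (adj G1 y) (λ w → ⌊ w ≟ x ⌋) ⟨
    count (adj G1 y)                                        ≡⟨ degree≡count G1 y ⟨
    degree G1 y                                             ∎
    where
    open ≡-Reasoning
    at-x off-x : Fin a → Bool
    at-x  w = adj G1 y w ∧ ⌊ w ≟ x ⌋
    off-x w = adj G1 y w ∧ not ⌊ w ≟ x ⌋
    one-at-x : count at-x ≡ 1
    one-at-x = trans (count-at (adj G1 y) x) (cong ind yx)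
    -- the only deleted edge at y is yx
    not-deleted-y : ∀ w → adj G1 y w ∧ not (deleted y w) ≡ off-x w
    not-deleted-y w = cong (λ t → adj G1 y w ∧ not t)
      (cong₂ (λ p q → (p ∧ ⌊ w ≟ y ⌋) ∨ (q ∧ ⌊ w ≟ x ⌋)) (≟-≢ (x≢y ∘ sym)) (≟-refl y))

  from-G1 : ∀ {B R : Fin a → Set} {B′ R′ : Fin (a + k) → Set}
          → (∀ {u w} → ¬ B u → ¬ B w → ¬ R u ⊎ ¬ R w → deleted u w ≡ false)
          → (∀ {w} → ¬ B w → ¬ R w → degree O (ι₁ w) ≡ degree G1 w)
          → (∀ {u} → ¬ B u → ¬ B′ (ι₁ u)) → (∀ {u} → ¬ B u → ¬ R u → ¬ R′ (ι₁ u))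
          → Gem G1 B R → Gem O B′ R′
  from-G1 not-deleted keeps-degree avoids core-avoids = map-gem (record
    { injective    = λ _ _ → ι₁-injective
    ; keeps-edge   = λ u-ok w-ok one-core → keeps-edge₁ (not-deleted u-ok w-ok one-core)
    ; keeps-degree = keeps-degree
    ; avoids       = avoids
    ; core-avoids  = core-avoids
    })

  from-G1-xy : ∀ {B : Fin a → Set} {B′ R′ : Fin (a + k) → Set}
             → (∀ {u} → ¬ B u → ¬ B′ (ι₁ u)) → (∀ {u} → ¬ B u → ¬ (u ≡ x ⊎ u ≡ y) → ¬ R′ (ι₁ u))
             → Gem G1 B (λ u → u ≡ x ⊎ u ≡ y) → Gem O B′ R′
  from-G1-xy = from-G1 (λ _ _ one-core → ¬-not λ uw → one-core-is-end one-core (deleted-ends uw))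
                       (λ _ not-end → degree-kept₁ (not-end ∘ inj₁) (not-end ∘ inj₂))
    where
    one-core-is-end : ∀ {u w} → ¬ (u ≡ x ⊎ u ≡ y) ⊎ ¬ (w ≡ x ⊎ w ≡ y) → ¬ ((u ≡ x × w ≡ y) ⊎ (u ≡ y × w ≡ x))
    one-core-is-end (inj₁ u-not-end) (inj₁ (u≡x , _)) = u-not-end (inj₁ u≡x)
    one-core-is-end (inj₁ u-not-end) (inj₂ (u≡y , _)) = u-not-end (inj₂ u≡y)
    one-core-is-end (inj₂ w-not-end) (inj₁ (_ , w≡y)) = w-not-end (inj₂ w≡y)
    one-core-is-end (inj₂ w-not-end) (inj₂ (_ , w≡x)) = w-not-end (inj₁ w≡x)

  -- The vertices of G2 other than z, placed in O (z itself is sent anywhere).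
  lift₂ : Fin (suc k) → Fin (a + k)
  lift₂ w with z ≟ w
  ... | yes _   = ι₁ x
  ... | no z≢w = ι₂ (punchOut z≢w)

  lift₂-≢ : ∀ {w} (z≢w : z ≢ w) → lift₂ w ≡ ι₂ (punchOut z≢w)
  lift₂-≢ {w} z≢w with z ≟ w
  ... | yes z≡w = ⊥-elim (z≢w z≡w)
  ... | no _    = cong ι₂ (punchOut-cong z refl)

  from-G2 : Symmetric G2 → ∀ {B R : Fin (suc k) → Set} {B′ R′ : Fin (a + k) → Set}
          → (∀ {w} → ¬ B w → z ≢ w)
          → (∀ {j} → ¬ B (punchIn z j) → ¬ B′ (ι₂ j))
          → (∀ {j} → ¬ B (punchIn z j) → ¬ R (punchIn z j) → ¬ R′ (ι₂ j))
          → Gem G2 B R → Gem O B′ R′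
  from-G2 sym₂ {B} {R} {B′} {R′} not-z avoids core-avoids = map-gem (record
    { injective    = λ u-ok w-ok eq → punchOut-injective (not-z u-ok) (not-z w-ok)
                       (ι₂-injective (trans (sym (lift₂-≢ _)) (trans eq (lift₂-≢ _))))
    ; keeps-edge   = λ {u} {w} u-ok w-ok _ uw → trans (cong₂ (adj O) (lift₂-≢ (not-z u-ok)) (lift₂-≢ (not-z w-ok)))
                       (trans (adj-ι₂ι₂ _ _) (trans (cong₂ (adj G2) (back u-ok) (back w-ok)) uw))
    ; keeps-degree = λ w-ok _ → trans (cong (degree O) (lift₂-≢ (not-z w-ok)))
                       (trans (degree-kept₂ sym₂ _) (cong (degree G2) (back w-ok)))
    ; avoids       = λ {u} u-ok → subst (λ v → ¬ B′ v) (sym (lift₂-≢ (not-z u-ok)))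
                       (avoids (subst (λ v → ¬ B v) (sym (back u-ok)) u-ok))
    ; core-avoids  = λ {u} u-ok u-not-core → subst (λ v → ¬ R′ v) (sym (lift₂-≢ (not-z u-ok)))
                       (core-avoids (subst (λ v → ¬ B v) (sym (back u-ok)) u-ok)
                                    (subst (λ v → ¬ R v) (sym (back u-ok)) u-not-core))
    })
    where
    back : ∀ {w} (w-ok : ¬ B w) → punchIn z (punchOut (not-z w-ok)) ≡ w
    back w-ok = punchIn-punchOut (not-z w-ok)

  symmetric : Symmetric G1 → Symmetric G2 → Symmetric O
  symmetric sym₁ sym₂ v v′ with part v | part v′
  ... | in₁ u | in₁ w = trans (adj-ι₁ι₁ u w)
          (trans (cong₂ (λ p q → p ∧ not q) (sym₁ u w) (deleted-sym ⌊ u ≟ x ⌋ ⌊ w ≟ y ⌋ ⌊ u ≟ y ⌋ ⌊ w ≟ x ⌋))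
                 (sym (adj-ι₁ι₁ w u)))
    where
    deleted-sym : ∀ p q r s → (p ∧ q) ∨ (r ∧ s) ≡ (s ∧ r) ∨ (q ∧ p)
    deleted-sym p q r s rewrite ∧-comm p q | ∧-comm r s = ∨-comm (q ∧ p) (s ∧ r)
  ... | in₂ i | in₂ j = trans (adj-ι₂ι₂ i j) (trans (sym₂ _ _) (sym (adj-ι₂ι₂ j i)))
  ... | in₁ u | in₂ j = trans (adj-ι₁ι₂ u j) (sym (adj-ι₂ι₁ j u))
  ... | in₂ j | in₁ u = trans (adj-ι₂ι₁ j u) (sym (adj-ι₁ι₂ u j))

  -- (A) and (C) for O, from (C) for G1 at xy and (A) for G2 at z: choose the side of O that does
  -- not contain the given vertex, resp. edge.  A cross edge has its G1-end in {x, y}.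
  module Invariants (I₁ : OreInvariants G1) (I₂ : OreInvariants G2) (xy : adj G1 x y ≡ true) where
    private
      module I₁ = OreInvariants I₁
      module I₂ = OreInvariants I₂

    gem₁ : Gem G1 ∅ (λ u → u ≡ x ⊎ u ≡ y)
    gem₁ = I₁.core-avoids-edges x y xy

    gem₂ : Gem G2 (_≡ z) ∅
    gem₂ = I₂.avoids-vertices z

    avoids-vertices : AvoidsVertices O
    avoids-vertices v with part v
    ... | in₁ u = from-G2 I₂.symmetric (λ w≢z → w≢z ∘ sym) (λ _ eq → ι₁≢ι₂ (sym eq)) (λ _ _ → id) gem₂
    ... | in₂ j = from-G1-xy (λ _ → ι₁≢ι₂) (λ _ _ → id) gem₁

    not-cross-end : ∀ {u j w} → cross u j ≡ true → ¬ (w ≡ x ⊎ w ≡ y) → ι₁ w ≢ ι₁ u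
    not-cross-end uj not-end eq = not-end (subst (λ t → t ≡ x ⊎ t ≡ y) (sym (ι₁-injective eq)) (cross-ends uj))

    core-avoids-edges : CoreAvoidsEdges O
    core-avoids-edges v v′ vv′ with part v | part v′
    ... | in₁ u | in₁ w = from-G2 I₂.symmetric (λ w≢z → w≢z ∘ sym) (λ _ → id)
                            (λ _ _ → [ ι₁≢ι₂ ∘ sym , ι₁≢ι₂ ∘ sym ]′) gem₂
    ... | in₂ i | in₂ j = from-G1-xy (λ _ → id) (λ _ _ → [ ι₁≢ι₂ , ι₁≢ι₂ ]′) gem₁
    ... | in₁ u | in₂ j = from-G1-xy (λ _ → id)
                            (λ _ not-end → [ not-cross-end (trans (sym (adj-ι₁ι₂ u j)) vv′) not-end , ι₁≢ι₂ ]′) gem₁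
    ... | in₂ j | in₁ u = from-G1-xy (λ _ → id)
                            (λ _ not-end → [ ι₁≢ι₂ , not-cross-end (trans (sym (adj-ι₂ι₁ j u)) vv′) not-end ]′) gem₁

    invariants : OreInvariants O
    invariants = record
      { symmetric         = symmetric I₁.symmetric I₂.symmetric
      ; avoids-vertices   = avoids-vertices
      ; core-avoids-edges = core-avoids-edges
      }

  -- Contracting G1 to the single vertex z: the inverse of the placement of G2 − z in O.
  collapse : Fin (a + k) → Fin (suc k)
  collapse v = [ (λ _ → z) , punchIn z ]′ (splitAt a v)

  collapse-ι₁ : ∀ u → collapse (ι₁ u) ≡ z
  collapse-ι₁ u rewrite splitAt-↑ˡ a u k = refl

  collapse-ι₂ : ∀ j → collapse (ι₂ j) ≡ punchIn z j
  collapse-ι₂ j rewrite splitAt-↑ʳ a k j = refl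

  InG2 : Fin (a + k) → Set
  InG2 v = ∃[ j ] (v ≡ ι₂ j)

  InG1 : Fin (a + k) → Set
  InG1 v = ∃[ u ] (v ≡ ι₁ u)

  which-part : ∀ v → InG1 v ⊎ InG2 v
  which-part v with part v
  ... | in₁ u = inj₁ (u , refl)
  ... | in₂ j = inj₂ (j , refl)

  in-G2? : ∀ v → Dec (InG2 v)
  in-G2? v with part v
  ... | in₁ u = no λ { (j , eq) → ι₁≢ι₂ eq }
  ... | in₂ j = yes (j , refl)

  in-G1? : ∀ v → Dec (InG1 v)
  in-G1? v with part v
  ... | in₁ u = yes (u , refl)
  ... | in₂ j = no λ { (u , eq) → ι₁≢ι₂ (sym eq) }

  collapse-injective : ∀ {v w} → InG2 v ⊎ InG2 w → collapse v ≡ collapse w → v ≡ w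
  collapse-injective {v} {w} one-in-G2 eq with part v | part w | one-in-G2
  ... | in₁ u | in₁ u′ | inj₁ (_ , eq′) = ⊥-elim (ι₁≢ι₂ eq′)
  ... | in₁ u | in₁ u′ | inj₂ (_ , eq′) = ⊥-elim (ι₁≢ι₂ eq′)
  ... | in₁ u | in₂ j  | _ =
    ⊥-elim (punchInᵢ≢i z j (trans (sym (collapse-ι₂ j)) (trans (sym eq) (collapse-ι₁ u))))
  ... | in₂ j | in₁ u  | _ =
    ⊥-elim (punchInᵢ≢i z j (trans (sym (collapse-ι₂ j)) (trans eq (collapse-ι₁ u))))
  ... | in₂ i | in₂ j  | _ =
    cong ι₂ (punchIn-injective z i j (trans (sym (collapse-ι₂ i)) (trans eq (collapse-ι₂ j))))

  collapse-adj : Symmetric G2 → ∀ {v w} → InG2 v ⊎ InG2 w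
               → adj O v w ≡ true → adj G2 (collapse v) (collapse w) ≡ true
  collapse-adj sym₂ {v} {w} one-in-G2 vw with part v | part w | one-in-G2
  ... | in₁ u | in₁ u′ | inj₁ (_ , eq) = ⊥-elim (ι₁≢ι₂ eq)
  ... | in₁ u | in₁ u′ | inj₂ (_ , eq) = ⊥-elim (ι₁≢ι₂ eq)
  ... | in₁ u | in₂ j  | _ = trans (cong₂ (adj G2) (collapse-ι₁ u) (collapse-ι₂ j))
                                   (proj₁ (cross-end {u} (trans (sym (adj-ι₁ι₂ u j)) vw)))
  ... | in₂ j | in₁ u  | _ = trans (cong₂ (adj G2) (collapse-ι₂ j) (collapse-ι₁ u))
                                   (trans (sym₂ _ z) (proj₁ (cross-end {u} (trans (sym (adj-ι₂ι₁ j u)) vw))))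
  ... | in₂ i | in₂ j  | _ = trans (cong₂ (adj G2) (collapse-ι₂ i) (collapse-ι₂ j)) (trans (sym (adj-ι₂ι₂ i j)) vw)

  -- Its other three vertices lie in G2 − z
  -- (a vertex of G1 adjacent to G2 − z is x or y, and xy is deleted), so contracting G1 to z
  -- turns it into a K4 of G2 through z.
  module K4-through-x (x≢y : x ≢ y) (T : Fin 4 → Fin (a + k)) (K : IsK4 O T)
                      {i₁ : Fin 4} (Ti₁ : T i₁ ≡ ι₁ x) {i₀ : Fin 4} {j₀ : Fin k} (Ti₀ : T i₀ ≡ ι₂ j₀) where
    open IsK4 K

    others-in-G2 : ∀ i → i ≢ i₁ → InG2 (T i)
    others-in-G2 i i≢i₁ with which-part (T i)
    ... | inj₂ in-G2 = in-G2
    ... | inj₁ (w , Ti≡w) = ⊥-elim (w-not-end (cross-ends w-j₀))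
      where
      i≢i₀ : i ≢ i₀
      i≢i₀ refl = ι₁≢ι₂ (trans (sym Ti≡w) Ti₀)
      w-j₀ : cross w j₀ ≡ true
      w-j₀ = trans (sym (adj-ι₁ι₂ w j₀)) (trans (cong₂ (adj O) (sym Ti≡w) (sym Ti₀)) (edges i i₀ i≢i₀))
      w-not-end : ¬ (w ≡ x ⊎ w ≡ y)
      w-not-end (inj₁ refl) = i≢i₁ (inj (trans Ti≡w (sym Ti₁)))
      w-not-end (inj₂ refl) with trans (sym (edges i₁ i (i≢i₁ ∘ sym))) (trans (cong₂ (adj O) Ti₁ Ti≡w) xy-deleted)
      ... | ()

    pair-in-G2 : ∀ i i′ → i ≢ i′ → InG2 (T i) ⊎ InG2 (T i′)
    pair-in-G2 i i′ i≢i′ with i ≟ i₁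
    ... | yes refl = inj₂ (others-in-G2 i′ (i≢i′ ∘ sym))
    ... | no i≢i₁  = inj₁ (others-in-G2 i i≢i₁)

    collapsed-K4 : Symmetric G2 → IsK4 G2 (collapse ∘ T)
    collapsed-K4 sym₂ = record
      { inj   = λ {i} {i′} eq → injective i i′ eq
      ; edges = λ i i′ i≢i′ → collapse-adj sym₂ (pair-in-G2 i i′ i≢i′) (edges i i′ i≢i′) }
      where
      injective : ∀ i i′ → collapse (T i) ≡ collapse (T i′) → i ≡ i′
      injective i i′ eq with i ≟ i′
      ... | yes i≡i′ = i≡i′
      ... | no i≢i′  = inj (collapse-injective (pair-in-G2 i i′ i≢i′) eq)

    others : Fin 3 → Fin k
    others m = proj₁ (others-in-G2 (punchIn i₁ m) (punchInᵢ≢i i₁ m))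

    others-placed : ∀ m → T (punchIn i₁ m) ≡ ι₂ (others m)
    others-placed m = proj₂ (others-in-G2 (punchIn i₁ m) (punchInᵢ≢i i₁ m))

    three-to-x : 3 ≤ count (cross x)
    three-to-x = count-≥ (cross x) others
      (λ {m} {m′} eq → punchIn-injective i₁ m m′
                         (inj (trans (others-placed m) (trans (cong ι₂ eq) (sym (others-placed m′))))))
      (λ m → trans (sym (adj-ι₁ι₂ x (others m)))
                   (trans (cong₂ (adj O) (sym Ti₁) (sym (others-placed m))) (edges i₁ _ (punchInᵢ≢i i₁ m ∘ sym))))

    -- If G2 is K5, then z has four neighbours, three of which are moved to x; so y receives
    -- exactly one of them (it receives at least one since z was split into two vertices of
    -- positive degree).
    one-to-y : G2 ≅ K5 → ∃[ j ] (cross y j ≡ true) → count (cross y) ≡ 1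
    one-to-y G2≅K5 (j , yj) = ≤-antisym
      (+-cancelˡ-≤ 3 _ _ (≤-trans (+-monoˡ-≤ (count (cross y)) three-to-x) (≤-reflexive shares)))
      (count-≥ (cross y) (λ _ → j) (λ { {zero} {zero} _ → refl }) (λ _ → yj))
      where
      open _≅_ G2≅K5
      open ≡-Reasoning
      z-loopless : adj G2 z z ≡ false
      z-loopless = trans (sym (adj-pres z z)) (cong not (≟-refl (to z)))
      shares : count (cross x) + count (cross y) ≡ 4
      shares = begin
        count (cross x) + count (cross y)  ≡⟨ cross-count x≢y ⟩
        count toZ                          ≡⟨ cong (λ b → ind b + count toZ) z-loopless ⟨
        ind (adj G2 z z) + count toZ       ≡⟨ count-remove (adj G2 z) z ⟨
        count (adj G2 z)                   ≡⟨ degree≡count G2 z ⟨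
        degree G2 z                        ≡⟨ Isomorphic.degree-to G2≅K5 z ⟨
        degree K5 (to z)                   ≡⟨ K5-degree (to z) ⟩
        4                                  ∎

    -- A gem of O disjoint from T: from (B) for G2 applied to the contracted K4, or, if G2 is
    -- K5, from (A) for G1 at x, in which case y keeps its degree by one-to-y.
    gem : OreInvariants G1 → Symmetric G2 → adj G1 x y ≡ true → ∃[ j ] (cross y j ≡ true)
        → G2 ≅ K5 ⊎ AvoidsK4s G2 → Gem O (λ v → ∃[ i ] (T i ≡ v)) ∅
    gem I₁ sym₂ xy to-y (inj₂ avoids-K4s₂) =
      from-G2 sym₂ (λ not-T z≡w → not-T (i₁ , trans (cong collapse Ti₁) (trans (collapse-ι₁ x) z≡w)))
                   (λ not-T (i , Ti≡j) → not-T (i , trans (cong collapse Ti≡j) (collapse-ι₂ _)))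
                   (λ _ _ → id)
                   (avoids-K4s₂ (collapse ∘ T) (collapsed-K4 sym₂))
    gem I₁ sym₂ xy to-y (inj₁ G2≅K5) =
      from-G1 not-deleted keeps-degree avoids (λ _ _ → id) (OreInvariants.avoids-vertices I₁ x)
      where
      not-deleted : ∀ {u w} → u ≢ x → w ≢ x → ¬ ⊥ ⊎ ¬ ⊥ → deleted u w ≡ false
      not-deleted u≢x w≢x _ = ¬-not λ uw → [ u≢x ∘ proj₁ , w≢x ∘ proj₂ ]′ (deleted-ends uw)
      keeps-degree : ∀ {w} → w ≢ x → ¬ ⊥ → degree O (ι₁ w) ≡ degree G1 w
      keeps-degree {w} w≢x _ with w ≟ y
      ... | yes refl = degree-kept-y x≢y (trans (OreInvariants.symmetric I₁ y x) xy) (one-to-y G2≅K5 to-y)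
      ... | no w≢y   = degree-kept₁ w≢x w≢y
      avoids : ∀ {u} → u ≢ x → ¬ (∃[ i ] (T i ≡ ι₁ u))
      avoids u≢x (i , Ti≡u) with i ≟ i₁
      ... | yes refl = u≢x (ι₁-injective (trans (sym Ti≡u) Ti₁))
      ... | no i≢i₁  = ι₁≢ι₂ (trans (sym Ti≡u) (proj₂ (others-in-G2 i i≢i₁)))

swap : ∀ {a k} (G1 : Graph a) (G2 : Graph (suc k)) x y z side
     → Ore.O G1 G2 x y z side ≅ Ore.O G1 G2 y x z (not ∘ side)
swap G1 G2 x y z side = record
  { to = id ; from = id ; from-to = λ _ → refl ; to-from = λ _ → refl ; adj-pres = same }
  where
  module X = Ore G1 G2 x y z side
  module Y = Ore G1 G2 y x z (not ∘ side)
  same-target : ∀ j → Y.target j ≡ X.target j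
  same-target j with side j
  ... | true  = refl
  ... | false = refl
  same-cross : ∀ u j → Y.cross u j ≡ X.cross u j
  same-cross u j = trans (Y.cross-target u j)
    (trans (cong (λ t → X.toZ j ∧ ⌊ u ≟ t ⌋) (same-target j)) (sym (X.cross-target u j)))
  same : ∀ v w → adj Y.O v w ≡ adj X.O v w
  same v w with X.part v | X.part w
  ... | X.in₁ u | X.in₁ u′ = trans (Y.adj-ι₁ι₁ u u′)
          (trans (cong (λ t → adj G1 u u′ ∧ not t) (∨-comm (⌊ u ≟ y ⌋ ∧ ⌊ u′ ≟ x ⌋) _)) (sym (X.adj-ι₁ι₁ u u′)))
  ... | X.in₁ u | X.in₂ j  = trans (Y.adj-ι₁ι₂ u j) (trans (same-cross u j) (sym (X.adj-ι₁ι₂ u j)))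
  ... | X.in₂ j | X.in₁ u  = trans (Y.adj-ι₂ι₁ j u) (trans (same-cross u j) (sym (X.adj-ι₂ι₁ j u)))
  ... | X.in₂ i | X.in₂ j  = trans (Y.adj-ι₂ι₂ i j) (sym (X.adj-ι₂ι₂ i j))

-- A K4 T of O inside G2 − z avoids the gem coming from G1, and one
-- inside G1 avoids the gem coming from G2.  Otherwise T has a vertex ι₁ u of G1 adjacent to a
-- vertex of G2 − z, so u is x (K4-through-x) or y (the same after swapping x and y).
module _ {a k} {G1 : Graph a} {G2 : Graph (suc k)} {x y : Fin a} {z : Fin (suc k)} {side : Fin k → Bool}
         (I₁ : OreInvariants G1) (I₂ : OreInvariants G2) (xy : adj G1 x y ≡ true) (x≢y : x ≢ y)
         (x-side : ∃[ j ] (adj G2 z (punchIn z j) ≡ true × side j ≡ true))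
         (y-side : ∃[ j ] (adj G2 z (punchIn z j) ≡ true × side j ≡ false))
         (G2-K5-or : G2 ≅ K5 ⊎ AvoidsK4s G2) where
  open Ore G1 G2 x y z side
  open Invariants I₁ I₂ xy
  module Y = Ore G1 G2 y x z (not ∘ side)

  sym₁ : Symmetric G1
  sym₁ = OreInvariants.symmetric I₁

  sym₂ : Symmetric G2
  sym₂ = OreInvariants.symmetric I₂

  -- a K4 through y is a K4 through x of the swapped composition
  through-y : ∀ T → IsK4 O T → ∀ {i₁} → T i₁ ≡ ι₁ y → ∀ {i₀ j₀} → T i₀ ≡ ι₂ j₀
            → Gem O (λ v → ∃[ i ] (T i ≡ v)) ∅
  through-y T K Ti₁ Ti₀ = Isomorphic.pull-back (swap G1 G2 x y z side) id id
    (Y.K4-through-x.gem (x≢y ∘ sym) T K′ Ti₁ Ti₀ I₁ sym₂ (trans (sym₁ y x) xy) (Y.to-y y-side′) G2-K5-or)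
    where
    y-side′ : ∃[ j ] (adj G2 z (punchIn z j) ≡ true × not (side j) ≡ false)
    y-side′ = let (j , zj , sj) = x-side in j , zj , cong not sj
    K′ : IsK4 Y.O T
    K′ = record { inj = IsK4.inj K
                ; edges = λ i j i≢j → trans (_≅_.adj-pres (swap G1 G2 x y z side) (T i) (T j))
                                            (IsK4.edges K i j i≢j) }

  ore-avoids-K4s : AvoidsK4s O
  ore-avoids-K4s T K with any? (λ i → in-G2? (T i))
  ... | no none-in-G2 =
    from-G2 sym₂ (λ w≢z → w≢z ∘ sym) (λ _ (i , Ti≡j) → none-in-G2 (i , _ , Ti≡j)) (λ _ _ → id) gem₂
  ... | yes (i₀ , j₀ , Ti₀) with any? (λ i → in-G1? (T i))
  ...   | no none-in-G1 = from-G1-xy (λ _ (i , Ti≡u) → none-in-G1 (i , _ , Ti≡u)) (λ _ _ → id) gem₁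
  ...   | yes (i₁ , u , Ti₁) with cross-ends {u} {j₀} u-j₀
    where
    i₁≢i₀ : i₁ ≢ i₀
    i₁≢i₀ refl = ι₁≢ι₂ (trans (sym Ti₁) Ti₀)
    u-j₀ : cross u j₀ ≡ true
    u-j₀ = trans (sym (adj-ι₁ι₂ u j₀)) (trans (cong₂ (adj O) (sym Ti₁) (sym Ti₀)) (IsK4.edges K i₁ i₀ i₁≢i₀))
  ...     | inj₁ refl = K4-through-x.gem x≢y T K Ti₁ Ti₀ I₁ sym₂ xy (to-y y-side) G2-K5-or
  ...     | inj₂ refl = through-y T K Ti₁ Ti₀

ore-invariants : ∀ {n} {G : Graph n} → Is5Ore G → OreInvariants G × (G ≅ K5 ⊎ AvoidsK4s G)
ore-invariants (base G≅K5) = Isomorphic.invariants G≅K5 K5-invariants , inj₁ G≅K5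
ore-invariants (comp {G1 = G1} {G2} {x} {y} {z} {side} P₁ P₂ xy x≢y x-side y-side G≅O) =
    Isomorphic.invariants G≅O (Ore.Invariants.invariants G1 G2 x y z side I₁ I₂ xy)
  , inj₂ (Isomorphic.avoids-K4s G≅O (ore-avoids-K4s I₁ I₂ xy x≢y x-side y-side (proj₂ (ore-invariants P₂))))
  where
  I₁ : OreInvariants G1
  I₁ = proj₁ (ore-invariants P₁)
  I₂ : OreInvariants G2
  I₂ = proj₁ (ore-invariants P₂)

lemma2p7 : ∀ {n} (H : Graph n) → Is5Ore H
    → (∀ (v : Fin n) → DiamondOrEmeraldAvoiding H (λ u → u ≡ v))
    × (¬ (H ≅ K5) → ∀ (T : Fin 4 → Fin n) → IsK4 H T
        → DiamondOrEmeraldAvoiding H (λ u → ∃[ j ] (T j ≡ u)))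
lemma2p7 H P with ore-invariants P
... | I , K5-or-B = (λ v → Gem⇒DiamondOrEmerald (OreInvariants.avoids-vertices I v))
                  , λ H≇K5 T K → Gem⇒DiamondOrEmerald ([ ⊥-elim ∘ H≇K5 , id ]′ K5-or-B T K)
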